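{- Let $n$ and $d_1<d_2$ be positive integers such that $4d_2-1<n$. If $K$ is a self-identifying code in $C_n(d_1,d_2)$, then: (i) for all $x\in K$, $|I(x)|>2$; (ii) for all $x\notin K$, there exists $i\in\{1,2\}$ such that $\{x-d_i,x+d_i\}\subseteq I(x)$; (iii) if $d_1=1$ and $d_2=3$, then for every $x\notin K$ with $|I(x)|=2$ we have $I(x)=\{x-3,x+3\}$.
   Context: All graphs are simple and undirected. For a graph $G=(V,E)$ and $u\in V$, $N[u]=\{u\}\cup\{v: uv\in E\}$. A code is a nonempty $K\subseteq V$, and $I(x)=I(K;x)=N[x]\cap K$. $K$ is self-identifying if $I(K;u)\setminus I(K;v)\neq\emptyset$ for all distinct $u,v\in V$. For positive integers $n$ and $d_1,\dots,d_k\le n/2$, the circulant graph $C_n(d_1,\dots,d_k)$ has vertex set $\mathbb{Z}_n$, and the open neighbourhood of $u$ is $\{u\pm d_1,\dots,u\pm d_k\}$ modulo $n$ (all arithmetic on vertices is modulo $n$). -}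

module Defs where

open import Data.Nat using (ℕ; _+_; _∸_; _%_; NonZero)
open import Data.Nat.DivMod using (_mod_)
open import Data.Fin using (Fin; toℕ; _≟_)
open import Data.Fin.Subset using (Subset; _∈_; _─_; Nonempty)
open import Data.Bool using (Bool; _∧_; _∨_)
open import Data.List using (List)
open import Data.Bool.ListAction using (any)
open import Data.Vec using (tabulate; lookup)
open import Relation.Nullary.Decidable using (⌊_⌋)

-- Vertices of the circulant graph C_n(d_1,...,d_k) are Fin n, representing ℤ_n.

plus : (n : ℕ) .{{_ : NonZero n}} → Fin n → ℕ → Fin n
plus n u d = (toℕ u + d) mod n

minus : (n : ℕ) .{{_ : NonZero n}} → Fin n → ℕ → Fin n
minus n u d = (toℕ u + (n ∸ (d % n))) mod n

inClosedNbhd : (n : ℕ) .{{_ : NonZero n}} → List ℕ → Fin n → Fin n → Bool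
inClosedNbhd n ds u v =
  ⌊ v ≟ u ⌋ ∨ any (λ d → ⌊ v ≟ plus n u d ⌋ ∨ ⌊ v ≟ minus n u d ⌋) ds

I : (n : ℕ) .{{_ : NonZero n}} → List ℕ → Subset n → Fin n → Subset n
I n ds K x = tabulate (λ v → lookup K v ∧ inClosedNbhd n ds x v)

SelfIdentifying : (n : ℕ) .{{_ : NonZero n}} → List ℕ → Subset n → Set
SelfIdentifying n ds K =
  Nonempty K × (∀ (u v : Fin n) → u ≢ v → Nonempty (I n ds K u ─ I n ds K v))
  where
  open import Data.Product using (_×_)
  open import Relation.Binary.PropositionalEquality using (_≢_)

-- Self-identification means I(x) ⊈ I(y) whenever x ≠ y, so a separator w ∈ I(x) ∖ I(y) always exists.
-- (i) For a codeword x, take a separator w of x from its neighbour x + d₁ and then a separator of x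
-- from w; together with x these are three distinct elements of I(x).
-- (ii) If x ∉ K and for both i one of x ± dᵢ is not a codeword, then I(x) ⊆ {x + s₁d₁, x + s₂d₂} for
-- some signs sᵢ, whence I(x) ⊆ I(x + s₁d₁ + s₂d₂); and x + s₁d₁ + s₂d₂ ≠ x because 0 < d₁ < d₂ and
-- d₁ + d₂ < n.
-- (iii) For (d₁, d₂) = (1, 3), I(x) = {x - 1, x + 1} would give I(x) ⊆ I(x + 2), so by (ii)
-- I(x) = {x - 3, x + 3}.
module Submission where

open import Defs
open import Data.Nat using (ℕ; _+_; _<_; _≤_; _*_; _∸_; _%_; NonZero; z≤n; s≤s; >-nonZero⁻¹)
open import Data.Nat.Properties hiding (_≟_)
open import Data.Nat.DivMod using (%-distribˡ-+; m%n%n≡m%n; m<n⇒m%n≡m; n%n≡0; m%n≤n; [m+n]%n≡m%n)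
open import Data.Fin using (Fin; toℕ; _≟_)
open import Data.Fin.Properties using (toℕ-injective; toℕ-fromℕ<; toℕ<n)
open import Data.Fin.Subset using (Subset; _∈_; _∉_; _⊆_; _⊈_; _─_; _-_; ∣_∣; ⁅_⁆; _∪_; inside; outside)
open import Data.Fin.Subset.Properties using (_∈?_; p─q⊆p; x∈p∧x≢y⇒x∈p-y; x∈p⇒∣p-x∣<∣p∣; ⊆-antisym; x∈p∪q⁺; x∈p∪q⁻; x∈⁅x⁆; x∈⁅y⁆⇒x≡y)
open import Data.Vec as Vec using (lookup; tabulate)
open import Data.Vec.Properties using (lookup∘tabulate; []=⇒lookup; lookup⇒[]=)
open import Data.Bool using (Bool; true; false; T; not; _∨_)
open import Data.Bool.Properties using (T-≡; T-∧; T-∨)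
open import Data.List using (List; _∷_; [])
open import Data.List.Relation.Unary.Any as Any using (Any; here; there)
open import Data.List.Relation.Unary.Any.Properties using (any⁺; any⁻)
open import Data.Product using (_×_; _,_; ∃-syntax; proj₁; proj₂)
open import Data.Sum using (_⊎_; inj₁; inj₂)
open import Data.Empty using (⊥-elim)
open import Function.Bundles using (_⇔_; mk⇔; Equivalence)
open import Relation.Nullary using (yes; no; contradiction)
open import Relation.Nullary.Decidable using (⌊_⌋; toWitness; fromWitness)
open import Relation.Binary.PropositionalEquality
open import Algebra.Properties.CommutativeSemigroup +-commutativeSemigroup using (x∙yz≈y∙xz)

open Equivalence using (to; from)

private
  variable
    m : ℕ

x∈p─q⇒x∉q : ∀ {p q : Subset m} {x} → x ∈ p ─ q → x ∉ q
x∈p─q⇒x∉q {p = inside Vec.∷ _} {outside Vec.∷ _} Vec.here ()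
x∈p─q⇒x∉q {p = _ Vec.∷ _} {_ Vec.∷ _} (Vec.there x∈p─q) (Vec.there x∈q) = x∈p─q⇒x∉q x∈p─q x∈q

x∈tabulate⇔ : ∀ {f : Fin m → Bool} {x} → x ∈ tabulate f ⇔ T (f x)
x∈tabulate⇔ {f = f} {x} = mk⇔
  (λ x∈ → T-≡ .from (trans (sym (lookup∘tabulate f x)) ([]=⇒lookup x∈)))
  (λ t → lookup⇒[]= x _ (trans (lookup∘tabulate f x) (T-≡ .to t)))

x∈p⇔T[lookup] : ∀ {p : Subset m} {x} → x ∈ p ⇔ T (lookup p x)
x∈p⇔T[lookup] {p = p} {x} = mk⇔ (λ x∈p → T-≡ .from ([]=⇒lookup x∈p)) (λ t → lookup⇒[]= x p (T-≡ .to t))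

three-distinct⇒3≤∣p∣ : ∀ {p : Subset m} {x y z} → x ∈ p → y ∈ p → z ∈ p →
                       x ≢ y → x ≢ z → y ≢ z → 3 ≤ ∣ p ∣
three-distinct⇒3≤∣p∣ {p = p} {x} {y} {z} x∈p y∈p z∈p x≢y x≢z y≢z =
  ≤-<-trans (≤-<-trans (≤-<-trans z≤n (x∈p⇒∣p-x∣<∣p∣ z∈p-x-y)) (x∈p⇒∣p-x∣<∣p∣ y∈p-x)) (x∈p⇒∣p-x∣<∣p∣ x∈p)
  where
  y∈p-x : y ∈ p - x
  y∈p-x = x∈p∧x≢y⇒x∈p-y y∈p (≢-sym x≢y)
  z∈p-x-y : z ∈ p - x - y
  z∈p-x-y = x∈p∧x≢y⇒x∈p-y (x∈p∧x≢y⇒x∈p-y z∈p (≢-sym x≢z)) (≢-sym y≢z)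

x∈p∧y∉p⇒x≢y : ∀ {p : Subset m} {x y} → x ∈ p → y ∉ p → x ≢ y
x∈p∧y∉p⇒x≢y x∈p y∉p refl = y∉p x∈p

⁅x⁆∪⁅y⁆⊆p : ∀ {p : Subset m} {x y} → x ∈ p → y ∈ p → ⁅ x ⁆ ∪ ⁅ y ⁆ ⊆ p
⁅x⁆∪⁅y⁆⊆p {p = p} {x} {y} x∈p y∈p z∈ with x∈p∪q⁻ ⁅ x ⁆ ⁅ y ⁆ z∈
... | inj₁ z∈⁅x⁆ = subst (_∈ p) (sym (x∈⁅y⁆⇒x≡y x z∈⁅x⁆)) x∈p
... | inj₂ z∈⁅y⁆ = subst (_∈ p) (sym (x∈⁅y⁆⇒x≡y y z∈⁅y⁆)) y∈p

∣p∣≡2⇒p≡⁅x⁆∪⁅y⁆ : ∀ {p : Subset m} {x y} → x ∈ p → y ∈ p → x ≢ y → ∣ p ∣ ≡ 2 → p ≡ ⁅ x ⁆ ∪ ⁅ y ⁆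
∣p∣≡2⇒p≡⁅x⁆∪⁅y⁆ {p = p} {x} {y} x∈p y∈p x≢y ∣p∣≡2 = ⊆-antisym p⊆ (⁅x⁆∪⁅y⁆⊆p x∈p y∈p)
  where
  p⊆ : p ⊆ ⁅ x ⁆ ∪ ⁅ y ⁆
  p⊆ {z} z∈p with z ≟ x | z ≟ y
  ... | yes refl | _        = x∈p∪q⁺ (inj₁ (x∈⁅x⁆ z))
  ... | no _     | yes refl = x∈p∪q⁺ (inj₂ (x∈⁅x⁆ z))
  ... | no z≢x   | no z≢y   =
    contradiction (subst (3 ≤_) ∣p∣≡2 (three-distinct⇒3≤∣p∣ x∈p y∈p z∈p x≢y (≢-sym z≢x) (≢-sym z≢y))) (n≮n 2)

module Circulant (n : ℕ) .{{_ : NonZero n}} where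

  [m%n+k]%n≡[m+k]%n : ∀ i k → (i % n + k) % n ≡ (i + k) % n
  [m%n+k]%n≡[m+k]%n i k = begin
    (i % n + k) % n             ≡⟨ %-distribˡ-+ (i % n) k n ⟩
    (i % n % n + k % n) % n     ≡⟨ cong (λ j → (j + k % n) % n) (m%n%n≡m%n i n) ⟩
    (i % n + k % n) % n         ≡⟨ %-distribˡ-+ i k n ⟨
    (i + k) % n                 ∎
    where open ≡-Reasoning

  toℕ-plus : ∀ u a → toℕ (plus n u a) ≡ (toℕ u + a) % n
  toℕ-plus u a = toℕ-fromℕ< _

  plus-cong : ∀ u {a b} → a % n ≡ b % n → plus n u a ≡ plus n u b
  plus-cong u {a} {b} a≡b = toℕ-injective (begin
    toℕ (plus n u a)              ≡⟨ toℕ-plus u a ⟩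
    (toℕ u + a) % n               ≡⟨ %-distribˡ-+ (toℕ u) a n ⟩
    (toℕ u % n + a % n) % n       ≡⟨ cong (λ k → (toℕ u % n + k) % n) a≡b ⟩
    (toℕ u % n + b % n) % n       ≡⟨ %-distribˡ-+ (toℕ u) b n ⟨
    (toℕ u + b) % n               ≡⟨ toℕ-plus u b ⟨
    toℕ (plus n u b)              ∎)
    where open ≡-Reasoning

  plus-assoc : ∀ u a b → plus n (plus n u a) b ≡ plus n u (a + b)
  plus-assoc u a b = toℕ-injective (begin
    toℕ (plus n (plus n u a) b)   ≡⟨ toℕ-plus (plus n u a) b ⟩
    (toℕ (plus n u a) + b) % n    ≡⟨ cong (λ k → (k + b) % n) (toℕ-plus u a) ⟩
    ((toℕ u + a) % n + b) % n     ≡⟨ [m%n+k]%n≡[m+k]%n (toℕ u + a) b ⟩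
    (toℕ u + a + b) % n           ≡⟨ cong (_% n) (+-assoc (toℕ u) a b) ⟩
    (toℕ u + (a + b)) % n         ≡⟨ toℕ-plus u (a + b) ⟨
    toℕ (plus n u (a + b))        ∎)
    where open ≡-Reasoning

  plus-identityʳ : ∀ u → plus n u 0 ≡ u
  plus-identityʳ u = toℕ-injective (begin
    toℕ (plus n u 0)  ≡⟨ toℕ-plus u 0 ⟩
    (toℕ u + 0) % n   ≡⟨ cong (_% n) (+-identityʳ (toℕ u)) ⟩
    toℕ u % n         ≡⟨ m<n⇒m%n≡m (toℕ<n u) ⟩
    toℕ u             ∎)
    where open ≡-Reasoning

  plus-injective : ∀ u {a b} → a < n → b < n → plus n u a ≡ plus n u b → a ≡ b
  plus-injective u {a} {b} a<n b<n ua≡ub = begin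
    a                                        ≡⟨ undo a<n ⟨
    toℕ (plus n (plus n u a) (n ∸ toℕ u))    ≡⟨ cong (λ v → toℕ (plus n v (n ∸ toℕ u))) ua≡ub ⟩
    toℕ (plus n (plus n u b) (n ∸ toℕ u))    ≡⟨ undo b<n ⟩
    b                                        ∎
    where
    open ≡-Reasoning
    undo : ∀ {c} → c < n → toℕ (plus n (plus n u c) (n ∸ toℕ u)) ≡ c
    undo {c} c<n = begin
      toℕ (plus n (plus n u c) (n ∸ toℕ u))  ≡⟨ cong toℕ (plus-assoc u c (n ∸ toℕ u)) ⟩
      toℕ (plus n u (c + (n ∸ toℕ u)))       ≡⟨ toℕ-plus u _ ⟩
      (toℕ u + (c + (n ∸ toℕ u))) % n        ≡⟨ cong (_% n) (x∙yz≈y∙xz (toℕ u) c _) ⟩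
      (c + (toℕ u + (n ∸ toℕ u))) % n        ≡⟨ cong (λ k → (c + k) % n) (m+[n∸m]≡n (<⇒≤ (toℕ<n u))) ⟩
      (c + n) % n                            ≡⟨ [m+n]%n≡m%n c n ⟩
      c % n                                  ≡⟨ m<n⇒m%n≡m c<n ⟩
      c                                      ∎

  -- Signed steps: step true is plus n and step false is minus n, definitionally.
  offset : Bool → ℕ → ℕ
  offset true  d = d
  offset false d = n ∸ d % n

  step : Bool → Fin n → ℕ → Fin n
  step s u d = plus n u (offset s d)

  offset-false : ∀ {d} → d < n → offset false d ≡ n ∸ d
  offset-false d<n = cong (n ∸_) (m<n⇒m%n≡m d<n)

  offset<n : ∀ s {d} → 0 < d → d < n → offset s d < n
  offset<n true  0<d d<n = d<n
  offset<n false 0<d d<n = subst (_< n) (sym (offset-false d<n)) (∸-monoʳ-< 0<d (<⇒≤ d<n))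

  offset-cancel : ∀ s d → (offset s d + offset (not s) d) % n ≡ 0 % n
  offset-cancel true d = begin
    (d + (n ∸ d % n)) % n        ≡⟨ [m%n+k]%n≡[m+k]%n d _ ⟨
    (d % n + (n ∸ d % n)) % n    ≡⟨ cong (_% n) (m+[n∸m]≡n (m%n≤n d n)) ⟩
    n % n                        ≡⟨ n%n≡0 n ⟩
    0                            ≡⟨ m<n⇒m%n≡m (>-nonZero⁻¹ n) ⟨
    0 % n                        ∎
    where open ≡-Reasoning
  offset-cancel false d = trans (cong (_% n) (+-comm (n ∸ d % n) d)) (offset-cancel true d)

  step-inverse : ∀ s u d → step (not s) (step s u d) d ≡ u
  step-inverse s u d = begin
    step (not s) (step s u d) d                ≡⟨ plus-assoc u (offset s d) (offset (not s) d) ⟩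
    plus n u (offset s d + offset (not s) d)   ≡⟨ plus-cong u (offset-cancel s d) ⟩
    plus n u 0                                 ≡⟨ plus-identityʳ u ⟩
    u                                          ∎
    where open ≡-Reasoning

  step-comm : ∀ s t u d e → step t (step s u d) e ≡ step s (step t u e) d
  step-comm s t u d e = begin
    step t (step s u d) e                ≡⟨ plus-assoc u (offset s d) (offset t e) ⟩
    plus n u (offset s d + offset t e)   ≡⟨ cong (plus n u) (+-comm (offset s d) (offset t e)) ⟩
    plus n u (offset t e + offset s d)   ≡⟨ plus-assoc u (offset t e) (offset s d) ⟨
    step s (step t u e) d                ∎
    where open ≡-Reasoning

  u≢plus : ∀ u {a} → 0 < a → a < n → u ≢ plus n u a
  u≢plus u 0<a a<n u≡ua = <⇒≢ 0<a (plus-injective u (>-nonZero⁻¹ n) a<n (trans (plus-identityʳ u) u≡ua))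

  minus≢plus : ∀ x {d} → 0 < d → d + d < n → minus n x d ≢ plus n x d
  minus≢plus x {d} 0<d d+d<n x-d≡x+d = <⇒≢ d+d<n (begin
    d + d            ≡⟨ cong (_+ d) (trans (sym (offset-false d<n)) (plus-injective x (offset<n false 0<d d<n) d<n x-d≡x+d)) ⟨
    (n ∸ d) + d      ≡⟨ m∸n+n≡m (<⇒≤ d<n) ⟩
    n                ∎)
    where
    open ≡-Reasoning
    d<n : d < n
    d<n = ≤-<-trans (m≤m+n d d) d+d<n

  ClosedNbhd : List ℕ → Fin n → Fin n → Set
  ClosedNbhd ds u v = v ≡ u ⊎ Any (λ d → ∃[ s ] v ≡ step s u d) ds

  ClosedNbhd-sym : ∀ {ds u v} → ClosedNbhd ds u v → ClosedNbhd ds v u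
  ClosedNbhd-sym (inj₁ v≡u) = inj₁ (sym v≡u)
  ClosedNbhd-sym {u = u} (inj₂ v∈) = inj₂ (Any.map back v∈)
    where
    back : ∀ {d} → ∃[ s ] _ ≡ step s u d → ∃[ s ] u ≡ step s _ d
    back {d} (s , refl) = not s , sym (step-inverse s u d)

  T[inClosedNbhd]⇔ : ∀ {ds u v} → T (inClosedNbhd n ds u v) ⇔ ClosedNbhd ds u v
  T[inClosedNbhd]⇔ {ds} {u} {v} = mk⇔ to′ from′
    where
    signed : ∀ {d} → T (⌊ v ≟ plus n u d ⌋ ∨ ⌊ v ≟ minus n u d ⌋) → ∃[ s ] v ≡ step s u d
    signed {d} t with T-∨ {⌊ v ≟ plus n u d ⌋} .to t
    ... | inj₁ t₊ = true , toWitness t₊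
    ... | inj₂ t₋ = false , toWitness t₋
    unsigned : ∀ {d} → ∃[ s ] v ≡ step s u d → T (⌊ v ≟ plus n u d ⌋ ∨ ⌊ v ≟ minus n u d ⌋)
    unsigned {d} (true  , v≡) = T-∨ {⌊ v ≟ plus n u d ⌋} .from (inj₁ (fromWitness v≡))
    unsigned {d} (false , v≡) = T-∨ {⌊ v ≟ plus n u d ⌋} .from (inj₂ (fromWitness v≡))
    to′ : T (inClosedNbhd n ds u v) → ClosedNbhd ds u v
    to′ t with T-∨ {⌊ v ≟ u ⌋} .to t
    ... | inj₁ t₀ = inj₁ (toWitness t₀)
    ... | inj₂ t₁ = inj₂ (Any.map signed (any⁻ _ ds t₁))
    from′ : ClosedNbhd ds u v → T (inClosedNbhd n ds u v)
    from′ (inj₁ v≡u) = T-∨ {⌊ v ≟ u ⌋} .from (inj₁ (fromWitness v≡u))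
    from′ (inj₂ v∈)  = T-∨ {⌊ v ≟ u ⌋} .from (inj₂ (any⁺ _ (Any.map unsigned v∈)))

  ∈I⇔ : ∀ ds K {u v} → v ∈ I n ds K u ⇔ (v ∈ K × ClosedNbhd ds u v)
  ∈I⇔ _ _ = mk⇔
    (λ v∈I → let tK , tN = T-∧ .to (x∈tabulate⇔ .to v∈I) in
             x∈p⇔T[lookup] .from tK , T[inClosedNbhd]⇔ .to tN)
    (λ (v∈K , u~v) → x∈tabulate⇔ .from (T-∧ .from (x∈p⇔T[lookup] .to v∈K , T[inClosedNbhd]⇔ .from u~v)))

  module SelfIdentifyingCode (ds : List ℕ) (K : Subset n) (SI : SelfIdentifying n ds K) where

    private
      ∈I : ∀ {u v} → v ∈ I n ds K u ⇔ (v ∈ K × ClosedNbhd ds u v)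
      ∈I = ∈I⇔ ds K

    separator : ∀ {x y} → x ≢ y → ∃[ w ] w ∈ I n ds K x × w ∉ I n ds K y
    separator x≢y with proj₂ SI _ _ x≢y
    ... | w , w∈Ix─Iy = w , p─q⊆p _ _ w∈Ix─Iy , x∈p─q⇒x∉q w∈Ix─Iy

    I⊈I : ∀ {x y} → x ≢ y → I n ds K x ⊈ I n ds K y
    I⊈I x≢y Ix⊆Iy with separator x≢y
    ... | w , w∈Ix , w∉Iy = w∉Iy (Ix⊆Iy w∈Ix)

    -- A separator of x from w is neither x nor w, since both lie in I(w).
    ∈K∧∈I⇒2<∣I∣ : ∀ {x w} → x ∈ K → w ∈ I n ds K x → x ≢ w → 2 < ∣ I n ds K x ∣
    ∈K∧∈I⇒2<∣I∣ {x} {w} x∈K w∈Ix x≢w with ∈I .to w∈Ix | separator x≢w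
    ... | w∈K , x~w | v , v∈Ix , v∉Iw = three-distinct⇒3≤∣p∣ x∈Ix w∈Ix v∈Ix x≢w
      (x∈p∧y∉p⇒x≢y (∈I .from (x∈K , ClosedNbhd-sym x~w)) v∉Iw)
      (x∈p∧y∉p⇒x≢y (∈I .from (w∈K , inj₁ refl)) v∉Iw)
      where
      x∈Ix : x ∈ I n ds K x
      x∈Ix = ∈I .from (x∈K , inj₁ refl)

    ∈K⇒2<∣I∣ : ∀ {x y} → x ∈ K → ClosedNbhd ds x y → x ≢ y → 2 < ∣ I n ds K x ∣
    ∈K⇒2<∣I∣ x∈K x~y x≢y with separator x≢y
    ... | w , w∈Ix , w∉Iy =
      ∈K∧∈I⇒2<∣I∣ x∈K w∈Ix (x∈p∧y∉p⇒x≢y (∈I .from (x∈K , ClosedNbhd-sym x~y)) w∉Iy)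

  module TwoDistances (d₁ d₂ : ℕ) (K : Subset n) where

    private
      ds : List ℕ
      ds = d₁ ∷ d₂ ∷ []
      ∈I : ∀ {u v} → v ∈ I n ds K u ⇔ (v ∈ K × ClosedNbhd ds u v)
      ∈I = ∈I⇔ ds K

    corner : Bool → Bool → Fin n → Fin n
    corner s₁ s₂ x = step s₂ (step s₁ x d₁) d₂

    sign-forced : ∀ s t x d {w} → step (not s) x d ∉ K → w ∈ K → w ≡ step t x d → w ≡ step s x d
    sign-forced true  true  _ _ _  _   w≡ = w≡
    sign-forced false false _ _ _  _   w≡ = w≡
    sign-forced true  false _ _ ∉K w∈K w≡ = contradiction (subst (_∈ K) w≡ w∈K) ∉K
    sign-forced false true  _ _ ∉K w∈K w≡ = contradiction (subst (_∈ K) w≡ w∈K) ∉K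

    -- The only codewords x could see are x + s₁d₁ = corner - s₂d₂ and x + s₂d₂ = corner - s₁d₁.
    I⊆I[corner] : ∀ {x} s₁ s₂ → x ∉ K → step (not s₁) x d₁ ∉ K → step (not s₂) x d₂ ∉ K →
                  I n ds K x ⊆ I n ds K (corner s₁ s₂ x)
    I⊆I[corner] {x} s₁ s₂ x∉K ∉₁ ∉₂ w∈Ix with ∈I .to w∈Ix
    ... | w∈K , inj₁ w≡x = contradiction (subst (_∈ K) w≡x w∈K) x∉K
    ... | w∈K , inj₂ (here (t , w≡)) = ∈I .from (w∈K , inj₂ (there (here (not s₂ ,
          trans (sign-forced s₁ t x d₁ ∉₁ w∈K w≡) (sym (step-inverse s₂ (step s₁ x d₁) d₂))))))
    ... | w∈K , inj₂ (there (here (t , w≡))) = ∈I .from (w∈K , inj₂ (here (not s₁ ,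
          trans (sign-forced s₂ t x d₂ ∉₂ w∈K w≡) (sym (begin
            step (not s₁) (corner s₁ s₂ x) d₁             ≡⟨ cong (λ v → step (not s₁) v d₁) (step-comm s₁ s₂ x d₁ d₂) ⟩
            step (not s₁) (step s₁ (step s₂ x d₂) d₁) d₁  ≡⟨ step-inverse s₁ (step s₂ x d₂) d₁ ⟩
            step s₂ x d₂                                  ∎)))))
      where open ≡-Reasoning

    Flanked : Fin n → ℕ → Set
    Flanked x d = minus n x d ∈ I n ds K x × plus n x d ∈ I n ds K x

    both-sides∈K⊎side∉K : ∀ x d → (minus n x d ∈ K × plus n x d ∈ K) ⊎ ∃[ s ] step (not s) x d ∉ K
    both-sides∈K⊎side∉K x d with minus n x d ∈? K | plus n x d ∈? K
    ... | yes x-d∈K | yes x+d∈K = inj₁ (x-d∈K , x+d∈K)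
    ... | no  x-d∉K | _         = inj₂ (true , x-d∉K)
    ... | yes _     | no x+d∉K  = inj₂ (false , x+d∉K)

    module Separated (0<d₁ : 0 < d₁) (d₁<d₂ : d₁ < d₂) (d₁+d₂<n : d₁ + d₂ < n) where

      d₁<n : d₁ < n
      d₁<n = ≤-<-trans (m≤m+n d₁ d₂) d₁+d₂<n

      d₂<n : d₂ < n
      d₂<n = ≤-<-trans (m≤n+m d₂ d₁) d₁+d₂<n

      offset₁≢offset₂ : ∀ s t → offset s d₁ ≢ offset t d₂
      offset₁≢offset₂ true  true  e = <⇒≢ d₁<d₂ e
      offset₁≢offset₂ true  false e = <⇒≢ d₁+d₂<n (begin
        d₁ + d₂          ≡⟨ cong (_+ d₂) (trans e (offset-false d₂<n)) ⟩
        (n ∸ d₂) + d₂    ≡⟨ m∸n+n≡m (<⇒≤ d₂<n) ⟩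
        n                ∎)
        where open ≡-Reasoning
      offset₁≢offset₂ false true  e = <⇒≢ d₁+d₂<n (begin
        d₁ + d₂          ≡⟨ cong (d₁ +_) (trans (sym e) (offset-false d₁<n)) ⟩
        d₁ + (n ∸ d₁)    ≡⟨ m+[n∸m]≡n (<⇒≤ d₁<n) ⟩
        n                ∎)
        where open ≡-Reasoning
      offset₁≢offset₂ false false e = <⇒≢ d₁<d₂
        (∸-cancelˡ-≡ (<⇒≤ d₁<n) (<⇒≤ d₂<n) (trans (sym (offset-false d₁<n)) (trans e (offset-false d₂<n))))

      step₁≢step₂ : ∀ s t x → step s x d₁ ≢ step t x d₂
      step₁≢step₂ s t x e = offset₁≢offset₂ s t
        (plus-injective x (offset<n s 0<d₁ d₁<n) (offset<n t (<-trans 0<d₁ d₁<d₂) d₂<n) e)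

      x≢corner : ∀ s₁ s₂ x → x ≢ corner s₁ s₂ x
      x≢corner s₁ s₂ x x≡c = step₁≢step₂ s₁ (not s₂) x (begin
        step s₁ x d₁                           ≡⟨ step-inverse s₂ (step s₁ x d₁) d₂ ⟨
        step (not s₂) (corner s₁ s₂ x) d₂      ≡⟨ cong (λ v → step (not s₂) v d₂) x≡c ⟨
        step (not s₂) x d₂                     ∎)
        where open ≡-Reasoning

      ∉K⇒flanked : SelfIdentifying n ds K → ∀ x → x ∉ K → Flanked x d₁ ⊎ Flanked x d₂
      ∉K⇒flanked SI x x∉K with both-sides∈K⊎side∉K x d₁ | both-sides∈K⊎side∉K x d₂
      ... | inj₁ (x-d₁∈K , x+d₁∈K) | _ =
        inj₁ (∈I .from (x-d₁∈K , inj₂ (here (false , refl))) , ∈I .from (x+d₁∈K , inj₂ (here (true , refl))))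
      ... | inj₂ _ | inj₁ (x-d₂∈K , x+d₂∈K) =
        inj₂ (∈I .from (x-d₂∈K , inj₂ (there (here (false , refl)))) , ∈I .from (x+d₂∈K , inj₂ (there (here (true , refl)))))
      ... | inj₂ (s₁ , ∉₁) | inj₂ (s₂ , ∉₂) =
        ⊥-elim (SelfIdentifyingCode.I⊈I ds K SI (x≢corner s₁ s₂ x) (I⊆I[corner] s₁ s₂ x∉K ∉₁ ∉₂))

  module OneThree (11<n : 11 < n) (K : Subset n) (SI : SelfIdentifying n (1 ∷ 3 ∷ []) K) where

    private
      ds : List ℕ
      ds = 1 ∷ 3 ∷ []
      ∈I : ∀ {u v} → v ∈ I n ds K u ⇔ (v ∈ K × ClosedNbhd ds u v)
      ∈I = ∈I⇔ ds K
      k≤11⇒k<n : ∀ {k} → k ≤ 11 → k < n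
      k≤11⇒k<n k≤11 = ≤-<-trans k≤11 11<n
      1<n : 1 < n
      1<n = k≤11⇒k<n (m≤m+n 1 10)
      2<n : 2 < n
      2<n = k≤11⇒k<n (m≤m+n 2 9)
      3<n : 3 < n
      3<n = k≤11⇒k<n (m≤m+n 3 8)
      4<n : 1 + 3 < n
      4<n = k≤11⇒k<n (m≤m+n 4 7)
      6<n : 3 + 3 < n
      6<n = k≤11⇒k<n (m≤m+n 6 5)

    open TwoDistances 1 3 K
    open Separated (s≤s z≤n) (s≤s (s≤s z≤n)) 4<n
    open SelfIdentifyingCode ds K SI

    x+1≡[x+2]-1 : ∀ x → plus n x 1 ≡ minus n (plus n x 2) 1
    x+1≡[x+2]-1 x = begin
      plus n x 1                               ≡⟨ step-inverse true (plus n x 1) 1 ⟨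
      minus n (plus n (plus n x 1) 1) 1        ≡⟨ cong (λ v → minus n v 1) (plus-assoc x 1 1) ⟩
      minus n (plus n x 2) 1                   ∎
      where open ≡-Reasoning

    x-1≡[x+2]-3 : ∀ x → minus n x 1 ≡ minus n (plus n x 2) 3
    x-1≡[x+2]-3 x = begin
      plus n x (offset false 1)                ≡⟨ cong (plus n x) (offset-false 1<n) ⟩
      plus n x (n ∸ 1)                         ≡⟨ cong (plus n x) (+-∸-assoc 2 (<⇒≤ 3<n)) ⟩
      plus n x (2 + (n ∸ 3))                   ≡⟨ plus-assoc x 2 (n ∸ 3) ⟨
      plus n (plus n x 2) (n ∸ 3)              ≡⟨ cong (plus n (plus n x 2)) (offset-false 3<n) ⟨
      plus n (plus n x 2) (offset false 3)     ∎
      where open ≡-Reasoning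

    ∉K⇒I≡⁅x-3⁆∪⁅x+3⁆ : ∀ x → x ∉ K → ∣ I n ds K x ∣ ≡ 2 → I n ds K x ≡ ⁅ minus n x 3 ⁆ ∪ ⁅ plus n x 3 ⁆
    ∉K⇒I≡⁅x-3⁆∪⁅x+3⁆ x x∉K ∣I∣≡2 with ∉K⇒flanked SI x x∉K
    ... | inj₂ (x-3∈I , x+3∈I) = ∣p∣≡2⇒p≡⁅x⁆∪⁅y⁆ x-3∈I x+3∈I (minus≢plus x (s≤s z≤n) 6<n) ∣I∣≡2
    ... | inj₁ (x-1∈I , x+1∈I) = ⊥-elim (I⊈I (u≢plus x (s≤s z≤n) 2<n) Ix⊆I[x+2])
      where
      Ix⊆I[x+2] : I n ds K x ⊆ I n ds K (plus n x 2)
      Ix⊆I[x+2] = subst (_⊆ I n ds K (plus n x 2))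
        (sym (∣p∣≡2⇒p≡⁅x⁆∪⁅y⁆ x-1∈I x+1∈I (minus≢plus x (s≤s z≤n) 2<n) ∣I∣≡2))
        (⁅x⁆∪⁅y⁆⊆p
          (∈I .from (proj₁ (∈I .to x-1∈I) , inj₂ (there (here (false , x-1≡[x+2]-3 x)))))
          (∈I .from (proj₁ (∈I .to x+1∈I) , inj₂ (here (false , x+1≡[x+2]-1 x)))))

4d₂∸1<n⇒d₁+d₂<n : ∀ {d₁ d₂ n} → d₁ < d₂ → 4 * d₂ ∸ 1 < n → d₁ + d₂ < n
4d₂∸1<n⇒d₁+d₂<n {d₁} {d₂} {n} d₁<d₂ 4d₂∸1<n = begin-strict
  d₁ + d₂            <⟨ +-monoˡ-< d₂ d₁<d₂ ⟩
  d₂ + d₂            ≤⟨ +-monoʳ-≤ d₂ (m≤m+n d₂ (d₂ + (d₂ + 0))) ⟩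
  4 * d₂             ≤⟨ m≤n+m∸n (4 * d₂) 1 ⟩
  1 + (4 * d₂ ∸ 1)   ≤⟨ 4d₂∸1<n ⟩
  n                  ∎
  where open ≤-Reasoning

proposition1 : (n d₁ d₂ : ℕ) .{{_ : NonZero n}} → 0 < d₁ → d₁ < d₂ → 4 * d₂ ∸ 1 < n →
  (K : Subset n) → SelfIdentifying n (d₁ ∷ d₂ ∷ []) K →
  ((x : Fin n) → x ∈ K → 2 < ∣ I n (d₁ ∷ d₂ ∷ []) K x ∣)
  × ((x : Fin n) → x ∉ K →
      ((minus n x d₁ ∈ I n (d₁ ∷ d₂ ∷ []) K x) × (plus n x d₁ ∈ I n (d₁ ∷ d₂ ∷ []) K x))
      ⊎ ((minus n x d₂ ∈ I n (d₁ ∷ d₂ ∷ []) K x) × (plus n x d₂ ∈ I n (d₁ ∷ d₂ ∷ []) K x)))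
  × (d₁ ≡ 1 → d₂ ≡ 3 → (x : Fin n) → x ∉ K → ∣ I n (d₁ ∷ d₂ ∷ []) K x ∣ ≡ 2 →
      I n (d₁ ∷ d₂ ∷ []) K x ≡ ⁅ minus n x 3 ⁆ ∪ ⁅ plus n x 3 ⁆)
proposition1 n d₁ d₂ 0<d₁ d₁<d₂ 4d₂∸1<n K SI =
    (λ x x∈K → ∈K⇒2<∣I∣ x∈K (inj₂ (here (true , refl))) (u≢plus x 0<d₁ d₁<n))
  , ∉K⇒flanked SI
  , λ { refl refl → OneThree.∉K⇒I≡⁅x-3⁆∪⁅x+3⁆ 4d₂∸1<n K SI }
  where
  open Circulant n
  open SelfIdentifyingCode (d₁ ∷ d₂ ∷ []) K SI
  open TwoDistances.Separated d₁ d₂ K 0<d₁ d₁<d₂ (4d₂∸1<n⇒d₁+d₂<n d₁<d₂ 4d₂∸1<n)
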